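{- Let $G$ be a graph and $v$ a vertex of $G$. Then $$\phi(G)\le \phi(G-v)+\phi(G-N[v])+\sum_{u\in N(v)}\phi\big(G-(N[v]\cup N[u])\big).$$ Moreover, if there exists a vertex $w\in N(v)$ such that $N[w]\subseteq N[v]$, then $$\phi(G)\le \phi(G-v)+\sum_{u\in N(v)}\phi\big(G-(N[v]\cup N[u])\big).$$
   Context: All graphs are finite, simple, undirected. A subset of vertices $F$ of a graph $G$ is a dissociation set if the induced subgraph $G[F]$ has maximum degree at most $1$. A maximal dissociation set is a dissociation set that is not a proper subset of any other dissociation set. $\phi(G)$ denotes the number of maximal dissociation sets of $G$ (for the graph with no vertices, $\phi=1$, the empty set being its unique maximal dissociation set). $N(v)$ is the neighborhood of $v$, $N[v]=N(v)\cup\{v\}$ the closed neighborhood, and for $S\subseteq V(G)$, $G-S$ is the subgraph induced by $V(G)\setminus S$; $G-v=G-\{v\}$. -}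

module Defs where

open import Data.Nat using (ℕ; zero; suc; _+_; _≤_)
open import Data.Nat.Properties using (_≤?_)
open import Data.Bool using (Bool; true; false)
open import Data.Fin using (Fin)
import Data.Fin as F
open import Data.Fin.Properties using (all?)
open import Data.Fin.Subset using (Subset; _∈_; _⊆_; _∩_; _∪_; ⁅_⁆; ∣_∣)
open import Data.Fin.Subset.Properties using (_∈?_; _⊆?_)
open import Data.Vec using (Vec; []; _∷_; tabulate)
open import Data.Product using (_×_; _,_; proj₁; proj₂)
open import Relation.Binary.PropositionalEquality using (_≡_)
open import Relation.Nullary using (Dec; yes; no; ¬_)
open import Relation.Nullary.Decidable using (_×-dec_; _→-dec_)

record Graph (n : ℕ) : Set where
  field
    adj    : Fin n → Fin n → Bool
    sym    : ∀ x y → adj x y ≡ adj y x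
    irrefl : ∀ x → adj x x ≡ false
open Graph public

module _ {n : ℕ} (G : Graph n) where

  N : Fin n → Subset n
  N v = tabulate (adj G v)

  N[_] : Fin n → Subset n
  N[ v ] = ⁅ v ⁆ ∪ N v

  degIn : Subset n → Fin n → ℕ
  degIn S x = ∣ N x ∩ S ∣

  IsDissociation : Subset n → Subset n → Set
  IsDissociation U S = S ⊆ U × (∀ x → x ∈ S → degIn S x ≤ 1)

  IsMaximalDissociation : Subset n → Subset n → Set
  IsMaximalDissociation U S =
    IsDissociation U S × (∀ T → IsDissociation U T → S ⊆ T → T ⊆ S)

∀Sub? : ∀ {n} {P : Subset n → Set} → (∀ s → Dec (P s)) → Dec (∀ s → P s)
∀Sub? {zero} {P} P? with P? []
... | yes p = yes λ { [] → p }
... | no ¬p = no λ h → ¬p (h [])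
∀Sub? {suc n} {P} P? with ∀Sub? (λ s → P? (true ∷ s)) | ∀Sub? (λ s → P? (false ∷ s))
... | yes p | yes q = yes λ { (true ∷ s) → p s ; (false ∷ s) → q s }
... | no ¬p | _ = no λ h → ¬p (λ s → h (true ∷ s))
... | yes _ | no ¬q = no λ h → ¬q (λ s → h (false ∷ s))

countSub : ∀ {n} {P : Subset n → Set} → (∀ s → Dec (P s)) → ℕ
countSub {zero} P? with P? []
... | yes _ = 1
... | no _ = 0
countSub {suc n} P? = countSub (λ s → P? (true ∷ s)) + countSub (λ s → P? (false ∷ s))

sumOver : ∀ {n} → Subset n → (Fin n → ℕ) → ℕ
sumOver [] f = 0
sumOver (true ∷ S) f = f F.zero + sumOver S (λ i → f (F.suc i))
sumOver (false ∷ S) f = sumOver S (λ i → f (F.suc i))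

module _ {n : ℕ} (G : Graph n) where

  isDissociation? : ∀ U S → Dec (IsDissociation G U S)
  isDissociation? U S =
    (S ⊆? U) ×-dec all? (λ x → (x ∈? S) →-dec (degIn G S x ≤? 1))

  isMaximalDissociation? : ∀ U S → Dec (IsMaximalDissociation G U S)
  isMaximalDissociation? U S =
    isDissociation? U S ×-dec
      ∀Sub? (λ T → isDissociation? U T →-dec ((S ⊆? T) →-dec (T ⊆? S)))

  -- φ(G[U]) : the number of maximal dissociation sets of the subgraph of G
  -- induced by U.  G - S is G[∁ S].
  φ : Subset n → ℕ
  φ U = countSub (isMaximalDissociation? U)

{-# OPTIONS --safe #-}
module Submission where

-- Classify a maximal dissociation set S of G by how it meets v: either v ∉ S, or v is isolated
-- in G[S], or v has a (unique) neighbour u in S.  In each case removing a set D ⊆ S (∅, {v} or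
-- {u, v}) leaves a maximal dissociation set of G - X for X = {v}, N[v] or N[v] ∪ N[u]: every
-- dissociation set of G - X can be enlarged by D, because no vertex outside X is adjacent to D.
-- Since S ↦ S ∖ D is injective on sets containing D, the three terms bound the three cases.
-- A neighbour w with N[w] ⊆ N[v] rules out the isolated case, as S ∪ {w} would stay dissociated.

open import Defs hiding (sym)
open import Data.Bool using (true; false)
open import Data.Fin using (Fin; _≟_)
import Data.Fin as Fin
open import Data.Fin.Properties using (any?; ¬Fin0)
open import Data.Fin.Subset
  using (Subset; ⊤; ⊥; ∁; ⁅_⁆; _∪_; _∩_; _─_; _-_; _∈_; _∉_; _⊆_; ∣_∣; Nonempty)
open import Data.Fin.Subset.Properties
open import Data.Nat using (ℕ; zero; suc; _+_; _≤_; z≤n; s≤s)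
import Data.Nat as ℕ
open import Data.Nat.Properties
  using (≤-refl; ≤-trans; ≤-reflexive; +-mono-≤; +-monoʳ-≤; m≤n+m; +-identityʳ; +-assoc; 1+n≰n; +-commutativeSemigroup; module ≤-Reasoning)
open import Algebra.Properties.CommutativeSemigroup +-commutativeSemigroup using (interchange)
open import Data.Product using (Σ; ∃; _×_; _,_; proj₁; proj₂)
open import Data.Sum using (_⊎_; inj₁; inj₂; swap)
open import Data.Vec using ([]; _∷_; here; there)
open import Data.Vec.Properties using ([]=⇒lookup; lookup⇒[]=; lookup∘tabulate)
open import Relation.Binary.PropositionalEquality
  using (_≡_; _≢_; refl; sym; trans; cong; cong₂; subst)
open import Function using (case_of_)
open import Relation.Nullary using (Dec; yes; no; ¬_; contradiction)
open import Relation.Nullary.Decidable using (_×-dec_; _⊎-dec_; ¬?)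

countSub≡0 : ∀ {n} {P : Subset n → Set} (P? : ∀ s → Dec (P s)) →
  (∀ s → ¬ P s) → countSub P? ≡ 0
countSub≡0 {zero} P? ¬P with P? []
... | yes p = contradiction p (¬P [])
... | no _ = refl
countSub≡0 {suc n} P? ¬P =
  cong₂ _+_ (countSub≡0 (λ s → P? (true ∷ s)) (λ s → ¬P _))
            (countSub≡0 (λ s → P? (false ∷ s)) (λ s → ¬P _))

countSub-⊎ : ∀ {n} {P Q R : Subset n → Set}
  (P? : ∀ s → Dec (P s)) (Q? : ∀ s → Dec (Q s)) (R? : ∀ s → Dec (R s)) →
  (∀ s → P s → Q s ⊎ R s) → countSub P? ≤ countSub Q? + countSub R?
countSub-⊎ {zero} P? Q? R? P⇒Q⊎R with P? [] | Q? [] | R? []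
... | no _  | _     | _    = z≤n
... | yes _ | yes _ | _    = s≤s z≤n
... | yes _ | no _  | yes _ = ≤-refl
... | yes p | no ¬q | no ¬r with P⇒Q⊎R [] p
...   | inj₁ q = contradiction q ¬q
...   | inj₂ r = contradiction r ¬r
countSub-⊎ {suc n} P? Q? R? P⇒Q⊎R = ≤-trans
  (+-mono-≤ (countSub-⊎ (λ s → P? (true ∷ s)) (λ s → Q? (true ∷ s)) (λ s → R? (true ∷ s))
                        (λ s → P⇒Q⊎R _))
            (countSub-⊎ (λ s → P? (false ∷ s)) (λ s → Q? (false ∷ s)) (λ s → R? (false ∷ s))
                        (λ s → P⇒Q⊎R _)))
  (≤-reflexive (interchange (countSub (λ s → Q? (true ∷ s))) (countSub (λ s → R? (true ∷ s)))
                            (countSub (λ s → Q? (false ∷ s))) (countSub (λ s → R? (false ∷ s)))))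

countSub-∃ : ∀ {k n} (S : Subset k) {P : Subset n → Set} (P? : ∀ s → Dec (P s))
  {Q : Fin k → Subset n → Set} (Q? : ∀ u s → Dec (Q u s)) →
  (∀ s → P s → ∃ λ u → u ∈ S × Q u s) → countSub P? ≤ sumOver S (λ u → countSub (Q? u))
countSub-∃ [] P? Q? P⇒∃ = ≤-reflexive (countSub≡0 P? (λ s p → ¬Fin0 (proj₁ (P⇒∃ s p))))
countSub-∃ (true ∷ S) {P} P? {Q} Q? P⇒∃ = ≤-trans
  (countSub-⊎ P? (Q? Fin.zero) Q⁺? here-or-later)
  (+-monoʳ-≤ (countSub (Q? Fin.zero)) (countSub-∃ S Q⁺? (λ u → Q? (Fin.suc u)) (λ s q → q)))
  where
  Q⁺ : Subset _ → Set
  Q⁺ s = ∃ λ u → u ∈ S × Q (Fin.suc u) s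
  Q⁺? : ∀ s → Dec (Q⁺ s)
  Q⁺? s = any? (λ u → (u ∈? S) ×-dec Q? (Fin.suc u) s)
  here-or-later : ∀ s → P s → Q Fin.zero s ⊎ Q⁺ s
  here-or-later s p with P⇒∃ s p
  ... | Fin.zero  , _   , q = inj₁ q
  ... | Fin.suc u , u∈S , q = inj₂ (u , drop-there u∈S , q)
countSub-∃ (false ∷ S) {P} P? {Q} Q? P⇒∃ = countSub-∃ S P? (λ u → Q? (Fin.suc u)) later
  where
  later : ∀ s → P s → ∃ λ u → u ∈ S × Q (Fin.suc u) s
  later s p with P⇒∃ s p
  ... | Fin.suc u , u∈S , q = u , drop-there u∈S , q

-- s ↦ s ─ D is injective on the sets containing D.
countSub-─ : ∀ {n} {P Q : Subset n → Set} (P? : ∀ s → Dec (P s)) (Q? : ∀ s → Dec (Q s))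
  (D : Subset n) → (∀ s → P s → D ⊆ s × Q (s ─ D)) → countSub P? ≤ countSub Q?
countSub-─ {zero} P? Q? [] P⇒Q with P? [] | Q? []
... | yes _ | yes _ = ≤-refl
... | yes p | no ¬q = contradiction (proj₂ (P⇒Q [] p)) ¬q
... | no _  | _     = z≤n
countSub-─ {suc n} {P} {Q} P? Q? (true ∷ D) P⇒Q = begin
  countSub P?₁ + countSub P?₀   ≡⟨ cong (countSub P?₁ +_) (countSub≡0 P?₀ zero∉) ⟩
  countSub P?₁ + 0              ≡⟨ +-identityʳ _ ⟩
  countSub P?₁                  ≤⟨ countSub-─ P?₁ Q?₀ D (λ s p → drop-∷-⊆ (proj₁ (P⇒Q _ p)) , proj₂ (P⇒Q _ p)) ⟩
  countSub Q?₀                  ≤⟨ m≤n+m _ _ ⟩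
  countSub Q?₁ + countSub Q?₀   ∎
  where
  open ≤-Reasoning
  P?₁ : ∀ s → Dec (P (true ∷ s))
  P?₁ s = P? (true ∷ s)
  P?₀ : ∀ s → Dec (P (false ∷ s))
  P?₀ s = P? (false ∷ s)
  Q?₁ : ∀ s → Dec (Q (true ∷ s))
  Q?₁ s = Q? (true ∷ s)
  Q?₀ : ∀ s → Dec (Q (false ∷ s))
  Q?₀ s = Q? (false ∷ s)
  zero∉ : ∀ s → ¬ P (false ∷ s)
  zero∉ s p with proj₁ (P⇒Q _ p) here
  ... | ()
countSub-─ {suc n} {P} {Q} P? Q? (false ∷ D) P⇒Q =
  +-mono-≤ (countSub-─ (λ s → P? (true ∷ s)) (λ s → Q? (true ∷ s)) D tail)
           (countSub-─ (λ s → P? (false ∷ s)) (λ s → Q? (false ∷ s)) D tail)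
  where
  tail : ∀ {b} s → P (b ∷ s) → D ⊆ s × Q (b ∷ (s ─ D))
  tail s p = drop-∷-⊆ (proj₁ (P⇒Q _ p)) , proj₂ (P⇒Q _ p)

sumOver-mono : ∀ {k} (S : Subset k) {f g : Fin k → ℕ} →
  (∀ {u} → u ∈ S → f u ≤ g u) → sumOver S f ≤ sumOver S g
sumOver-mono []          f≤g = z≤n
sumOver-mono (true ∷ S)  f≤g = +-mono-≤ (f≤g here) (sumOver-mono S (λ u∈S → f≤g (there u∈S)))
sumOver-mono (false ∷ S) f≤g = sumOver-mono S (λ u∈S → f≤g (there u∈S))

x∈p─q⇒x∉q : ∀ {n} {x : Fin n} (p q : Subset n) → x ∈ p ─ q → x ∉ q
x∈p─q⇒x∉q (_ ∷ p) (true  ∷ q) (there x∈p─q) (there x∈q) = x∈p─q⇒x∉q p q x∈p─q x∈q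
x∈p─q⇒x∉q (_ ∷ p) (false ∷ q) (there x∈p─q) (there x∈q) = x∈p─q⇒x∉q p q x∈p─q x∈q

module _ {n : ℕ} where

  x∈p⇒⁅x⁆⊆p : ∀ {x : Fin n} {p} → x ∈ p → ⁅ x ⁆ ⊆ p
  x∈p⇒⁅x⁆⊆p {x} x∈p y∈⁅x⁆ = subst (_∈ _) (sym (x∈⁅y⁆⇒x≡y x y∈⁅x⁆)) x∈p

  x∈p⇒1≤∣p∣ : ∀ {x : Fin n} {p} → x ∈ p → 1 ≤ ∣ p ∣
  x∈p⇒1≤∣p∣ {x} x∈p = subst (_≤ _) (∣⁅x⁆∣≡1 x) (p⊆q⇒∣p∣≤∣q∣ (x∈p⇒⁅x⁆⊆p x∈p))

  p⊆⁅x⁆⇒∣p∣≤1 : ∀ {x : Fin n} {p} → p ⊆ ⁅ x ⁆ → ∣ p ∣ ≤ 1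
  p⊆⁅x⁆⇒∣p∣≤1 {x} p⊆⁅x⁆ = subst (_ ≤_) (∣⁅x⁆∣≡1 x) (p⊆q⇒∣p∣≤∣q∣ p⊆⁅x⁆)

  ∣p∣≤1⇒x≡y : ∀ {x y : Fin n} {p} → ∣ p ∣ ≤ 1 → x ∈ p → y ∈ p → x ≡ y
  ∣p∣≤1⇒x≡y {x} {y} ∣p∣≤1 x∈p y∈p with x ≟ y
  ... | yes x≡y = x≡y
  ... | no x≢y  = contradiction
    (≤-trans (s≤s (x∈p⇒1≤∣p∣ (x∈p∧x≢y⇒x∈p-y x∈p x≢y))) (≤-trans (x∈p⇒∣p-x∣<∣p∣ y∈p) ∣p∣≤1))
    1+n≰n

  p⊆r∧q⊆r⇒p∪q⊆r : ∀ {p q r : Subset n} → p ⊆ r → q ⊆ r → p ∪ q ⊆ r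
  p⊆r∧q⊆r⇒p∪q⊆r {p} {q} p⊆r q⊆r x∈p∪q with x∈p∪q⁻ p q x∈p∪q
  ... | inj₁ x∈p = p⊆r x∈p
  ... | inj₂ x∈q = q⊆r x∈q

  ∣p∣≢0⇒Nonempty : ∀ (p : Subset n) → ∣ p ∣ ≢ 0 → Nonempty p
  ∣p∣≢0⇒Nonempty p ∣p∣≢0 with nonempty? p
  ... | yes ne = ne
  ... | no ¬ne = contradiction (trans (cong ∣_∣ (Empty-unique ¬ne)) (∣⊥∣≡0 n)) ∣p∣≢0

module _ {n : ℕ} (G : Graph n) where

  ∈N⇒adj : ∀ {v x} → x ∈ N G v → adj G v x ≡ true
  ∈N⇒adj {v} {x} x∈Nv = trans (sym (lookup∘tabulate (adj G v) x)) ([]=⇒lookup x∈Nv)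

  adj⇒∈N : ∀ {v x} → adj G v x ≡ true → x ∈ N G v
  adj⇒∈N {v} {x} vx = lookup⇒[]= x _ (trans (lookup∘tabulate (adj G v) x) vx)

  N-sym : ∀ {v x} → x ∈ N G v → v ∈ N G x
  N-sym {v} {x} x∈Nv = adj⇒∈N (trans (Graph.sym G x v) (∈N⇒adj x∈Nv))

  N-irrefl : ∀ {v} → v ∉ N G v
  N-irrefl {v} v∈Nv with trans (sym (∈N⇒adj v∈Nv)) (Graph.irrefl G v)
  ... | ()

  v∈N[v] : ∀ {v} → v ∈ N[_] G v
  v∈N[v] {v} = x∈p∪q⁺ (inj₁ (x∈⁅x⁆ v))

  N⊆N[] : ∀ {v} → N G v ⊆ N[_] G v
  N⊆N[] x∈Nv = x∈p∪q⁺ (inj₂ x∈Nv)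

  x∈⁅y⁆⇒N[x]⊆N[y] : ∀ {x y} → x ∈ ⁅ y ⁆ → N[_] G x ⊆ N[_] G y
  x∈⁅y⁆⇒N[x]⊆N[y] {y = y} x∈⁅y⁆ rewrite x∈⁅y⁆⇒x≡y y x∈⁅y⁆ = λ z∈N[y] → z∈N[y]

  x∈N[v]⁻ : ∀ {v x} → x ∈ N[_] G v → x ≡ v ⊎ x ∈ N G v
  x∈N[v]⁻ {v} x∈N[v] with x∈p∪q⁻ ⁅ v ⁆ (N G v) x∈N[v]
  ... | inj₁ x∈⁅v⁆ = inj₁ (x∈⁅y⁆⇒x≡y v x∈⁅v⁆)
  ... | inj₂ x∈Nv  = inj₂ x∈Nv

  degIn-mono : ∀ {S T x} → (∀ {y} → y ∈ N G x → y ∈ S → y ∈ T) → degIn G S x ≤ degIn G T x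
  degIn-mono {S} {T} {x} S⊆T = p⊆q⇒∣p∣≤∣q∣ λ y∈Nx∩S →
    let (y∈Nx , y∈S) = x∈p∩q⁻ (N G x) S y∈Nx∩S in x∈p∩q⁺ (y∈Nx , S⊆T y∈Nx y∈S)

  degIn≤1 : ∀ {S x z} → (∀ {y} → y ∈ N G x → y ∈ S → y ≡ z) → degIn G S x ≤ 1
  degIn≤1 {S} {x} {z} only-z = p⊆⁅x⁆⇒∣p∣≤1 λ y∈Nx∩S →
    let (y∈Nx , y∈S) = x∈p∩q⁻ (N G x) S y∈Nx∩S in subst (_∈ ⁅ z ⁆) (sym (only-z y∈Nx y∈S)) (x∈⁅x⁆ z)

  degIn≡0⇒∉ : ∀ {S x y} → degIn G S x ≡ 0 → y ∈ N G x → y ∉ S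
  degIn≡0⇒∉ deg≡0 y∈Nx y∈S with ≤-trans (x∈p⇒1≤∣p∣ (x∈p∩q⁺ (y∈Nx , y∈S))) (≤-reflexive deg≡0)
  ... | ()

  degIn≢0⇒∃ : ∀ {S x} → degIn G S x ≢ 0 → ∃ λ y → y ∈ N G x × y ∈ S
  degIn≢0⇒∃ {S} {x} deg≢0 =
    let (y , y∈Nx∩S) = ∣p∣≢0⇒Nonempty (N G x ∩ S) deg≢0 in y , x∈p∩q⁻ (N G x) S y∈Nx∩S

  dissociation-⊆ : ∀ {U V S T} → T ⊆ U → T ⊆ S → IsDissociation G V S → IsDissociation G U T
  dissociation-⊆ T⊆U T⊆S (_ , S-deg) =
    T⊆U , λ x x∈T → ≤-trans (degIn-mono (λ _ → T⊆S)) (S-deg x (T⊆S x∈T))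

  dissociation-unique-neighbour : ∀ {U S x y z} → IsDissociation G U S → x ∈ S →
    y ∈ N G x → y ∈ S → z ∈ N G x → z ∈ S → y ≡ z
  dissociation-unique-neighbour (_ , S-deg) x∈S y∈Nx y∈S z∈Nx z∈S =
    ∣p∣≤1⇒x≡y (S-deg _ x∈S) (x∈p∩q⁺ (y∈Nx , y∈S)) (x∈p∩q⁺ (z∈Nx , z∈S))

  ∪-dissociation : ∀ {S T} → IsDissociation G ⊤ S → IsDissociation G ⊤ T →
    (∀ {x y} → x ∈ S → y ∈ T → y ∉ N G x) → IsDissociation G ⊤ (S ∪ T)
  ∪-dissociation {S} {T} (_ , S-deg) (_ , T-deg) no-edge = ⊆⊤ , deg
    where
    deg : ∀ x → x ∈ S ∪ T → degIn G (S ∪ T) x ≤ 1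
    deg x x∈S∪T with x∈p∪q⁻ S T x∈S∪T
    ... | inj₁ x∈S = ≤-trans (degIn-mono only-S) (S-deg x x∈S)
      where
      only-S : ∀ {y} → y ∈ N G x → y ∈ S ∪ T → y ∈ S
      only-S y∈Nx y∈S∪T with x∈p∪q⁻ S T y∈S∪T
      ... | inj₁ y∈S = y∈S
      ... | inj₂ y∈T = contradiction y∈Nx (no-edge x∈S y∈T)
    ... | inj₂ x∈T = ≤-trans (degIn-mono only-T) (T-deg x x∈T)
      where
      only-T : ∀ {y} → y ∈ N G x → y ∈ S ∪ T → y ∈ T
      only-T y∈Nx y∈S∪T with x∈p∪q⁻ S T y∈S∪T
      ... | inj₁ y∈S = contradiction (N-sym y∈Nx) (no-edge y∈S x∈T)
      ... | inj₂ y∈T = y∈T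

  pair-dissociation : ∀ u w → IsDissociation G ⊤ (⁅ u ⁆ ∪ ⁅ w ⁆)
  pair-dissociation u w = ⊆⊤ , deg
    where
    x∈pair⁻ : ∀ {x} → x ∈ ⁅ u ⁆ ∪ ⁅ w ⁆ → x ≡ u ⊎ x ≡ w
    x∈pair⁻ x∈pair with x∈p∪q⁻ ⁅ u ⁆ ⁅ w ⁆ x∈pair
    ... | inj₁ x∈⁅u⁆ = inj₁ (x∈⁅y⁆⇒x≡y u x∈⁅u⁆)
    ... | inj₂ x∈⁅w⁆ = inj₂ (x∈⁅y⁆⇒x≡y w x∈⁅w⁆)
    other : ∀ {x y a b} → x ≡ a → y ∈ N G x → y ≡ a ⊎ y ≡ b → y ≡ b
    other refl y∈Nx (inj₁ refl) = contradiction y∈Nx N-irrefl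
    other _    _    (inj₂ y≡b)  = y≡b
    deg : ∀ x → x ∈ ⁅ u ⁆ ∪ ⁅ w ⁆ → degIn G (⁅ u ⁆ ∪ ⁅ w ⁆) x ≤ 1
    deg x x∈pair with x∈pair⁻ x∈pair
    ... | inj₁ x≡u = degIn≤1 λ y∈Nx y∈pair → other x≡u y∈Nx (x∈pair⁻ y∈pair)
    ... | inj₂ x≡w = degIn≤1 λ y∈Nx y∈pair → other x≡w y∈Nx (swap (x∈pair⁻ y∈pair))

  maximal-─ : ∀ {S D X} → IsMaximalDissociation G ⊤ S → D ⊆ S →
    (∀ {y} → y ∈ D → N[_] G y ⊆ X) → S ─ D ⊆ ∁ X → IsMaximalDissociation G (∁ X) (S ─ D)
  maximal-─ {S} {D} {X} (S-diss , S-max) D⊆S N[D]⊆X S─D⊆∁X =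
    dissociation-⊆ S─D⊆∁X (p─q⊆p S D) S-diss , maximal
    where
    maximal : ∀ T → IsDissociation G (∁ X) T → S ─ D ⊆ T → T ⊆ S ─ D
    maximal T T-diss@(T⊆∁X , _) S─D⊆T {x} x∈T =
      x∈p∧x∉q⇒x∈p─q (T∪D⊆S (p⊆p∪q D x∈T)) λ x∈D → ∉X x∈T (N[D]⊆X x∈D v∈N[v])
      where
      ∉X : ∀ {y} → y ∈ T → y ∉ X
      ∉X y∈T = x∈∁p⇒x∉p (T⊆∁X y∈T)
      T∪D-diss : IsDissociation G ⊤ (T ∪ D)
      T∪D-diss = ∪-dissociation (dissociation-⊆ ⊆⊤ (λ y∈T → y∈T) T-diss) (dissociation-⊆ ⊆⊤ D⊆S S-diss)
        λ y∈T z∈D z∈Ny → ∉X y∈T (N[D]⊆X z∈D (N⊆N[] (N-sym z∈Ny)))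
      S⊆T∪D : S ⊆ T ∪ D
      S⊆T∪D {y} y∈S with y ∈? D
      ... | yes y∈D = q⊆p∪q T D y∈D
      ... | no  y∉D = p⊆p∪q D (S─D⊆T (x∈p∧x∉q⇒x∈p─q y∈S y∉D))
      T∪D⊆S : T ∪ D ⊆ S
      T∪D⊆S = S-max (T ∪ D) T∪D-diss S⊆T∪D

  isolated⇒S-v⊆∁N[v] : ∀ {S v} → degIn G S v ≡ 0 → S - v ⊆ ∁ (N[_] G v)
  isolated⇒S-v⊆∁N[v] {S} {v} deg≡0 {x} x∈S-v = x∉p⇒x∈∁p λ x∈N[v] → case x∈N[v]⁻ x∈N[v] of λ
    { (inj₁ x≡v)  → x∈p─q⇒x∉q S ⁅ v ⁆ x∈S-v (subst (_∈ ⁅ v ⁆) (sym x≡v) (x∈⁅x⁆ v))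
    ; (inj₂ x∈Nv) → degIn≡0⇒∉ deg≡0 x∈Nv (p─q⊆p S ⁅ v ⁆ x∈S-v) }

  edge⇒S─vu⊆∁N[v]∪N[u] : ∀ {U S v u} → IsDissociation G U S → v ∈ S → u ∈ S → u ∈ N G v →
    S ─ (⁅ v ⁆ ∪ ⁅ u ⁆) ⊆ ∁ (N[_] G v ∪ N[_] G u)
  edge⇒S─vu⊆∁N[v]∪N[u] {S = S} {v} {u} S-diss v∈S u∈S u∈Nv {x} x∈S─vu =
    x∉p⇒x∈∁p λ x∈X → case x∈p∪q⁻ (N[_] G v) (N[_] G u) x∈X of λ
      { (inj₁ x∈N[v]) → x∉N[a] v∈S u∈S u∈Nv (q⊆p∪q _ _ (x∈⁅x⁆ u)) (p⊆p∪q _ (x∈⁅x⁆ v)) x∈N[v]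
      ; (inj₂ x∈N[u]) → x∉N[a] u∈S v∈S (N-sym u∈Nv) (p⊆p∪q _ (x∈⁅x⁆ v)) (q⊆p∪q _ _ (x∈⁅x⁆ u)) x∈N[u] }
    where
    x∈S : x ∈ S
    x∈S = p─q⊆p S _ x∈S─vu
    x∉vu : x ∉ ⁅ v ⁆ ∪ ⁅ u ⁆
    x∉vu = x∈p─q⇒x∉q S _ x∈S─vu
    x∉N[a] : ∀ {a b} → a ∈ S → b ∈ S → b ∈ N G a →
      b ∈ ⁅ v ⁆ ∪ ⁅ u ⁆ → a ∈ ⁅ v ⁆ ∪ ⁅ u ⁆ → x ∉ N[_] G a
    x∉N[a] a∈S b∈S b∈Na b∈vu a∈vu x∈N[a] with x∈N[v]⁻ x∈N[a]
    ... | inj₁ refl = x∉vu a∈vu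
    ... | inj₂ x∈Na = x∉vu (subst (_∈ _) (sym (dissociation-unique-neighbour S-diss a∈S x∈Na x∈S b∈Na b∈S)) b∈vu)

module MaximalDissociationCases {n : ℕ} (G : Graph n) (v : Fin n) where

  Maximal : Subset n → Set
  Maximal = IsMaximalDissociation G ⊤

  Avoiding Isolating : Subset n → Set
  Avoiding  S = Maximal S × v ∉ S
  Isolating S = Maximal S × v ∈ S × degIn G S v ≡ 0

  PairedWith : Fin n → Subset n → Set
  PairedWith u S = Maximal S × v ∈ S × u ∈ S

  Paired : Subset n → Set
  Paired S = ∃ λ u → u ∈ N G v × PairedWith u S

  avoiding? : ∀ S → Dec (Avoiding S)
  avoiding? S = isMaximalDissociation? G ⊤ S ×-dec ¬? (v ∈? S)

  isolating? : ∀ S → Dec (Isolating S)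
  isolating? S = isMaximalDissociation? G ⊤ S ×-dec (v ∈? S) ×-dec (degIn G S v ℕ.≟ 0)

  pairedWith? : ∀ u S → Dec (PairedWith u S)
  pairedWith? u S = isMaximalDissociation? G ⊤ S ×-dec (v ∈? S) ×-dec (u ∈? S)

  paired? : ∀ S → Dec (Paired S)
  paired? S = any? λ u → (u ∈? N G v) ×-dec pairedWith? u S

  classify : ∀ S → Maximal S → Avoiding S ⊎ (Isolating S ⊎ Paired S)
  classify S S-max with v ∈? S
  ... | no v∉S = inj₁ (S-max , v∉S)
  ... | yes v∈S with degIn G S v ℕ.≟ 0
  ...   | yes deg≡0 = inj₂ (inj₁ (S-max , v∈S , deg≡0))
  ...   | no deg≢0  = let (u , u∈Nv , u∈S) = degIn≢0⇒∃ G deg≢0 in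
                      inj₂ (inj₂ (u , u∈Nv , S-max , v∈S , u∈S))

  count-avoiding : countSub avoiding? ≤ φ G (∁ ⁅ v ⁆)
  count-avoiding = countSub-─ avoiding? (isMaximalDissociation? G _) ⊥ λ S (S-max , v∉S) →
    ⊥⊆ , maximal-─ G S-max ⊥⊆ (λ y∈⊥ → contradiction y∈⊥ ∉⊥)
           (λ {x} x∈S─⊥ → x∉p⇒x∈∁p λ x∈⁅v⁆ →
              v∉S (subst (_∈ S) (x∈⁅y⁆⇒x≡y v x∈⁅v⁆) (p─q⊆p S ⊥ x∈S─⊥)))

  count-isolating : countSub isolating? ≤ φ G (∁ (N[_] G v))
  count-isolating = countSub-─ isolating? (isMaximalDissociation? G _) ⁅ v ⁆
    λ S (S-max , v∈S , deg≡0) →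
      x∈p⇒⁅x⁆⊆p v∈S ,
      maximal-─ G S-max (x∈p⇒⁅x⁆⊆p v∈S)
        (x∈⁅y⁆⇒N[x]⊆N[y] G)
        (isolated⇒S-v⊆∁N[v] G deg≡0)

  φ-paired : ℕ
  φ-paired = sumOver (N G v) (λ u → φ G (∁ (N[_] G v ∪ N[_] G u)))

  count-paired : countSub paired? ≤ φ-paired
  count-paired = ≤-trans (countSub-∃ (N G v) paired? pairedWith? (λ S S-paired → S-paired))
    (sumOver-mono (N G v) λ {u} u∈Nv →
      countSub-─ (pairedWith? u) (isMaximalDissociation? G _) (⁅ v ⁆ ∪ ⁅ u ⁆)
        λ S (S-max , v∈S , u∈S) →
          let vu⊆S = p⊆r∧q⊆r⇒p∪q⊆r (x∈p⇒⁅x⁆⊆p v∈S) (x∈p⇒⁅x⁆⊆p u∈S) in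
          vu⊆S , maximal-─ G S-max vu⊆S N[vu]⊆N[v]∪N[u]
                   (edge⇒S─vu⊆∁N[v]∪N[u] G (proj₁ S-max) v∈S u∈S u∈Nv))
    where
    N[vu]⊆N[v]∪N[u] : ∀ {u y} → y ∈ ⁅ v ⁆ ∪ ⁅ u ⁆ → N[_] G y ⊆ N[_] G v ∪ N[_] G u
    N[vu]⊆N[v]∪N[u] {u} y∈vu with x∈p∪q⁻ ⁅ v ⁆ ⁅ u ⁆ y∈vu
    ... | inj₁ y∈⁅v⁆ = ⊆-trans (x∈⁅y⁆⇒N[x]⊆N[y] G y∈⁅v⁆) (p⊆p∪q _)
    ... | inj₂ y∈⁅u⁆ = ⊆-trans (x∈⁅y⁆⇒N[x]⊆N[y] G y∈⁅u⁆) (q⊆p∪q _ _)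

  -- S ∪ {w} = (S - v) ∪ {v, w}, and every neighbour of v or w lies in N[v], which S - v avoids.
  dominated⇒¬isolating : ∀ {w S} → w ∈ N G v → N[_] G w ⊆ N[_] G v → ¬ Isolating S
  dominated⇒¬isolating {w} {S} w∈Nv N[w]⊆N[v] ((S-diss , S-max) , v∈S , deg≡0) =
    degIn≡0⇒∉ G deg≡0 w∈Nv (S'⊆S (q⊆p∪q _ _ (q⊆p∪q _ _ (x∈⁅x⁆ w))))
    where
    S' : Subset n
    S' = (S - v) ∪ (⁅ v ⁆ ∪ ⁅ w ⁆)
    N[vw]⊆N[v] : ∀ {y} → y ∈ ⁅ v ⁆ ∪ ⁅ w ⁆ → N[_] G y ⊆ N[_] G v
    N[vw]⊆N[v] y∈vw with x∈p∪q⁻ ⁅ v ⁆ ⁅ w ⁆ y∈vw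
    ... | inj₁ y∈⁅v⁆ = x∈⁅y⁆⇒N[x]⊆N[y] G y∈⁅v⁆
    ... | inj₂ y∈⁅w⁆ = ⊆-trans (x∈⁅y⁆⇒N[x]⊆N[y] G y∈⁅w⁆) N[w]⊆N[v]
    S'-diss : IsDissociation G ⊤ S'
    S'-diss = ∪-dissociation G (dissociation-⊆ G ⊆⊤ (p─q⊆p S _) S-diss) (pair-dissociation G v w)
      λ x∈S-v y∈vw y∈Nx →
        x∈∁p⇒x∉p (isolated⇒S-v⊆∁N[v] G deg≡0 x∈S-v) (N[vw]⊆N[v] y∈vw (N⊆N[] G (N-sym G y∈Nx)))
    S⊆S' : S ⊆ S'
    S⊆S' {y} y∈S with y ≟ v
    ... | yes refl = q⊆p∪q _ _ (p⊆p∪q _ (x∈⁅x⁆ v))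
    ... | no  y≢v  = p⊆p∪q _ (x∈p∧x≢y⇒x∈p-y y∈S y≢v)
    S'⊆S : S' ⊆ S
    S'⊆S = S-max S' S'-diss S⊆S'

lemma2p2 : ∀ {n} (G : Graph n) (v : Fin n) →
    (φ G ⊤ ≤ φ G (∁ ⁅ v ⁆) + φ G (∁ (N[_] G v))
               + sumOver (N G v) (λ u → φ G (∁ (N[_] G v ∪ N[_] G u))))
    × (Σ (Fin n) (λ w → w ∈ N G v × N[_] G w ⊆ N[_] G v) →
       φ G ⊤ ≤ φ G (∁ ⁅ v ⁆)
               + sumOver (N G v) (λ u → φ G (∁ (N[_] G v ∪ N[_] G u))))
lemma2p2 G v = bound , dominated-bound
  where
  open MaximalDissociationCases G v
  open ≤-Reasoning
  bound : φ G ⊤ ≤ φ G (∁ ⁅ v ⁆) + φ G (∁ (N[_] G v)) + φ-paired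
  bound = begin
    φ G ⊤
      ≤⟨ countSub-⊎ _ avoiding? (λ S → isolating? S ⊎-dec paired? S) classify ⟩
    countSub avoiding? + countSub (λ S → isolating? S ⊎-dec paired? S)
      ≤⟨ +-monoʳ-≤ (countSub avoiding?) (countSub-⊎ _ isolating? paired? (λ _ S-case → S-case)) ⟩
    countSub avoiding? + (countSub isolating? + countSub paired?)
      ≡⟨ +-assoc (countSub avoiding?) _ _ ⟨
    countSub avoiding? + countSub isolating? + countSub paired?
      ≤⟨ +-mono-≤ (+-mono-≤ count-avoiding count-isolating) count-paired ⟩
    φ G (∁ ⁅ v ⁆) + φ G (∁ (N[_] G v)) + φ-paired
      ∎
  dominated-bound : Σ (Fin _) (λ w → w ∈ N G v × N[_] G w ⊆ N[_] G v) →
    φ G ⊤ ≤ φ G (∁ ⁅ v ⁆) + φ-paired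
  dominated-bound (w , w∈Nv , N[w]⊆N[v]) = begin
    φ G ⊤                                  ≤⟨ countSub-⊎ _ avoiding? paired? not-isolating ⟩
    countSub avoiding? + countSub paired?  ≤⟨ +-mono-≤ count-avoiding count-paired ⟩
    φ G (∁ ⁅ v ⁆) + φ-paired               ∎
    where
    not-isolating : ∀ S → Maximal S → Avoiding S ⊎ Paired S
    not-isolating S S-max with classify S S-max
    ... | inj₁ S-avoiding         = inj₁ S-avoiding
    ... | inj₂ (inj₁ S-isolating) = contradiction S-isolating (dominated⇒¬isolating w∈Nv N[w]⊆N[v])
    ... | inj₂ (inj₂ S-paired)    = inj₂ S-paired
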